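{- Let $t$ be a closed term. The following are equivalent: $t$ is $\rhd\mathsf{shuf}$-normal; $t$ is $\rhd\beta_v$-normal; $t$ is a value; $t=\lambda x.u$ for some term $u$ with $\mathrm{Fv}(u)\subseteq\{x\}$.
   Context: Terms: $t ::= x \mid \lambda x.t \mid tu$ (up to $\alpha$); values $v ::= x \mid \lambda x.t$; $\mathrm{Fv}(t)$ free variables, closed means $\mathrm{Fv}(t)=\emptyset$; $t\{v/x\}$ substitution. Root steps: ($\beta_v$) $(\lambda x.t)v \mapsto t\{v/x\}$, $v$ a value; ($\sigma_1$) $(\lambda x.t)us \mapsto (\lambda x.ts)u$ if $x\notin\mathrm{Fv}(s)$; ($\sigma_3$) $v((\lambda x.s)u)\mapsto(\lambda x.vs)u$ if $v$ a value, $x\notin\mathrm{Fv}(v)$. Balanced contexts $B ::= [\cdot] \mid (\lambda x.B)t \mid Bt \mid tB$; $\rhd\beta_v$-reduction is the closure of the $\beta_v$ root step under balanced contexts, $\rhd\mathsf{shuf}$-reduction the closure of the union of the three root steps under balanced contexts; normal means no such step applies. -}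

module Defs where

open import Data.Nat using (ℕ; zero; suc; _<_; _≥_; _<?_; _+_; compare; less; equal; greater)
open import Relation.Nullary using (¬_; yes; no)
open import Data.Empty using (⊥)

-- Untyped λ-terms in de Bruijn notation (α-equivalence is syntactic equality).
data Term : Set where
  var : ℕ → Term
  lam : Term → Term
  app : Term → Term → Term

data Value : Term → Set where
  var : ∀ i → Value (var i)
  lam : ∀ t → Value (lam t)

data _∈Fv_ : ℕ → Term → Set where
  here : ∀ {i} → i ∈Fv var i
  lam  : ∀ {i t} → suc i ∈Fv t → i ∈Fv lam t
  appˡ : ∀ {i t u} → i ∈Fv t → i ∈Fv app t u
  appʳ : ∀ {i t u} → i ∈Fv u → i ∈Fv app t u

Closed : Term → Set
Closed t = ∀ i → ¬ (i ∈Fv t)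

shift : ℕ → Term → Term
shift c (var i) with i <? c
... | yes _ = var i
... | no  _ = var (suc i)
shift c (lam t) = lam (shift (suc c) t)
shift c (app t u) = app (shift c t) (shift c u)

-- subst j s t : replace the variable with index j in t by s, and decrement
-- the indices above j (the binder of j is being removed); s is already
-- expressed in the context of t (shifted under the binders crossed).
subst : ℕ → Term → Term → Term
subst j s (var i) with compare i j
... | less _ _    = var i
... | equal _     = s
... | greater _ k = var (j + k)
subst j s (lam t) = lam (subst (suc j) (shift 0 s) t)
subst j s (app t u) = app (subst j s t) (subst j s u)

-- t{v/x} where t is the body of λx.t (x has index 0).
_[_] : Term → Term → Term
t [ v ] = subst 0 v t

data _↦βv_ : Term → Term → Set where
  βv : ∀ {t v} → Value v → app (lam t) v ↦βv (t [ v ])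

-- In de Bruijn notation the side conditions x ∉ Fv(s), x ∉ Fv(v) are
-- automatic: s (resp. v) is shifted when moved under the binder.
data _↦shuf_ : Term → Term → Set where
  βv : ∀ {t v} → Value v → app (lam t) v ↦shuf (t [ v ])
  σ₁ : ∀ {t u s} → app (app (lam t) u) s ↦shuf app (lam (app t (shift 0 s))) u
  σ₃ : ∀ {v s u} → Value v →
       app v (app (lam s) u) ↦shuf app (lam (app (shift 0 v) s)) u

data Balanced (R : Term → Term → Set) : Term → Term → Set where
  root  : ∀ {t t'} → R t t' → Balanced R t t'
  λctx  : ∀ {b b' t} → Balanced R b b' → Balanced R (app (lam b) t) (app (lam b') t)
  appL  : ∀ {b b' t} → Balanced R b b' → Balanced R (app b t) (app b' t)
  appR  : ∀ {b b' t} → Balanced R b b' → Balanced R (app t b) (app t b')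

_▷βv_ : Term → Term → Set
_▷βv_ = Balanced _↦βv_

_▷shuf_ : Term → Term → Set
_▷shuf_ = Balanced _↦shuf_

Normal : (Term → Term → Set) → Term → Set
Normal R t = ∀ t' → ¬ R t t'

-- A closed term is either an abstraction or has a ▷βv-redex: descend through
-- the applicative spine, where a closed term can never be a variable, until
-- both sides of an application are abstractions. Hence a ▷βv-normal closed
-- term is a value, while values are even ▷shuf-normal since no root step and
-- no balanced context applies to a variable or an abstraction.
module Submission where

open import Defs
open import Data.Nat using (zero; suc)
open import Data.Product using (Σ; _×_; _,_)
open import Data.Sum using (_⊎_; inj₁; inj₂)
open import Data.Empty using (⊥-elim)
open import Function using (_∘_)
open import Function.Bundles using (_⇔_; mk⇔)
open import Relation.Binary.PropositionalEquality using (_≡_; refl)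

▷βv⇒▷shuf : ∀ {t t'} → t ▷βv t' → t ▷shuf t'
▷βv⇒▷shuf (root (βv v)) = root (βv v)
▷βv⇒▷shuf (λctx s)      = λctx (▷βv⇒▷shuf s)
▷βv⇒▷shuf (appL s)      = appL (▷βv⇒▷shuf s)
▷βv⇒▷shuf (appR s)      = appR (▷βv⇒▷shuf s)

Normal-▷shuf⇒Normal-▷βv : ∀ {t} → Normal _▷shuf_ t → Normal _▷βv_ t
Normal-▷shuf⇒Normal-▷βv n t' s = n t' (▷βv⇒▷shuf s)

Value⇒Normal-▷shuf : ∀ {t} → Value t → Normal _▷shuf_ t
Value⇒Normal-▷shuf (var i) _ (root ())
Value⇒Normal-▷shuf (lam u) _ (root ())

closed-appˡ : ∀ {t u} → Closed (app t u) → Closed t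
closed-appˡ c i p = c i (appˡ p)

closed-appʳ : ∀ {t u} → Closed (app t u) → Closed u
closed-appʳ c i p = c i (appʳ p)

closed-progress : ∀ t → Closed t → (Σ Term λ u → t ≡ lam u) ⊎ (Σ Term λ t' → t ▷βv t')
closed-progress (var i) c = ⊥-elim (c i here)
closed-progress (lam u) c = inj₁ (u , refl)
closed-progress (app t u) c with closed-progress t (closed-appˡ c)
... | inj₂ (_ , s) = inj₂ (_ , appL s)
... | inj₁ (_ , refl) with closed-progress u (closed-appʳ c)
...   | inj₂ (_ , s) = inj₂ (_ , appR s)
...   | inj₁ (u' , refl) = inj₂ (_ , root (βv (lam u')))

closed-Normal-▷βv⇒Value : ∀ {t} → Closed t → Normal _▷βv_ t → Value t
closed-Normal-▷βv⇒Value {t} c n with closed-progress t c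
... | inj₁ (u , refl) = lam u
... | inj₂ (t' , s)   = ⊥-elim (n t' s)

closed-lam-Fv⊆0 : ∀ {u} → Closed (lam u) → ∀ i → i ∈Fv u → i ≡ zero
closed-lam-Fv⊆0 c zero    _ = refl
closed-lam-Fv⊆0 c (suc i) p = ⊥-elim (c i (lam p))

closed-Value⇒lam : ∀ {t} → Closed t → Value t →
  Σ Term (λ u → (t ≡ lam u) × (∀ i → i ∈Fv u → i ≡ zero))
closed-Value⇒lam c (var i) = ⊥-elim (c i here)
closed-Value⇒lam c (lam u) = u , refl , closed-lam-Fv⊆0 c

lam⇒Value : ∀ {t} → Σ Term (λ u → (t ≡ lam u) × (∀ i → i ∈Fv u → i ≡ zero)) → Value t
lam⇒Value (u , refl , _) = lam u

mainTheorem12 : (t : Term) → Closed t →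
    (Normal _▷shuf_ t ⇔ Normal _▷βv_ t)
    × (Normal _▷βv_ t ⇔ Value t)
    × (Value t ⇔ Σ Term (λ u → (t ≡ lam u) × (∀ i → i ∈Fv u → i ≡ zero)))
mainTheorem12 t c =
    mk⇔ Normal-▷shuf⇒Normal-▷βv (Value⇒Normal-▷shuf ∘ closed-Normal-▷βv⇒Value c)
  , mk⇔ (closed-Normal-▷βv⇒Value c) (Normal-▷shuf⇒Normal-▷βv ∘ Value⇒Normal-▷shuf)
  , mk⇔ (closed-Value⇒lam c) lam⇒Value
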